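{- Let $G=(V,E)$ be a connected finite multigraph without loops with $n=|V|$, $m=|E|$, cellularly embedded on a closed orientable surface of genus $g$, with dual $D(G)=(V',E')$, and let $\hat\omega$, $\Theta$, $H^*$ and the walks $w(k,\vec v)$ be as defined below. Suppose $w$ is a circuit of $D(G)$ with $\hat\omega(\overrightarrow w)=k$, $\Theta(\overrightarrow w)=\vec v$ and $|\overrightarrow w|\le m$. Then $w(k,\vec v)$ is defined and \[ |\overrightarrow w|\ \ge\ |\overrightarrow{w(k,\vec v)}|. \]
   Context: Edge space $\mathcal{E}(H)$: free abelian group on oriented edges modulo $\overleftarrow e=-\overrightarrow e$; $|\rho|=\sum\lambda_{\overrightarrow e}$ for the unique representation $\rho=\sum\lambda_{\overrightarrow e}\overrightarrow e$ with $\min(\lambda_{\overrightarrow e},\lambda_{\overleftarrow e})=0$. For a walk $(x_1,e_1,\ldots,e_{k-1},x_k)$ its oriented version is $\sum(x_i,e_i,x_{i+1})$; a circuit is a closed walk with distinct edges. Dual $D(G)$: vertex per face of $G$, edge $D(e)$ per edge $e$ joining the faces on either side; $D(\overrightarrow e)=(D(left(\overrightarrow e)),D(e),D(right(\overrightarrow e)))$, extended to an isomorphism $D:\mathcal{E}(G)\to\mathcal{E}(D(G))$. Fix $v_0\in V$ and a homomorphism $\omega:\mathcal{E}(G)\to\mathbb{Z}$ with $|\omega(\overrightarrow e)|\le n$ for all oriented edges and $\omega(\sum_{e=ab,a\in S,b\notin S}(a,e,b))=|V\setminus S|$ for all $v_0\in S\subseteq V$; $\hat\omega=\omega\circ D^{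 -1}$. $\Theta:\mathcal{E}(D(G))\to\mathbb{Z}^{2g}$: for a system of loops $c(1),\ldots,c(2g)$ of $G$ (cycles through a common vertex cutting the surface into a disk), oriented, $\Theta(\sigma)=(\Theta_{\overrightarrow{c(i)}}(\sigma))_i$, where $\Theta_{\overrightarrow e}(\overrightarrow{e^*})$ is $1$ if $D(\overrightarrow e)=\overrightarrow{e^*}$, $-1$ if $D(\overrightarrow e)=-\overrightarrow{e^*}$, $0$ otherwise, extended bilinearly. $H^*$ is the graph with vertex set $V'\times\{ -mn,\ldots,mn\}\times\{ -m,\ldots,m\}^{2g}$ in which, for each oriented edge $\overrightarrow e=(u_1,e,u_2)$ of $D(G)$ and each $(k,\vec v)$, there is an edge joining $(u_1,k,\vec v)$ and $(u_2,k+\hat\omega(\overrightarrow e),\vec v+\Theta(\overrightarrow e))$ whenever both lie in the vertex set (the two orientations of $e$ give the same edge); path length is number of edges. For $(u,k,\vec v)$ in the vertex set, $p(u,k,\vec v)$ is a (arbitrarily chosen) shortest path in $H^*$ from $(u,0,\vec 0)$ to $(u,k,\vec v)$, if one exists; $p(k,\vec v)$ is one of minimum length among the existing $p(u,k,\vec v)$, $u\in V'$ (defined if at least one exists); $w(k,\vec v)$ is the closed walk of $D(G)$ obtained by projecting $p(k,\vec v)$ to the first coordinates and the underlying edges of $D(G)$, and $\overrightarrow{w(k,\vec v)}$ is its oriented version in $\mathcal{E}(D(G))$. -}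

module Defs where

open import Data.Nat as ℕ using (ℕ; zero; suc; _∸_)
open import Data.Integer as ℤ using (ℤ; +_; -_; 0ℤ; _+_; _*_)
open import Data.Fin using (Fin; zero; suc)
open import Data.Bool using (Bool; true; false; not; _∧_; if_then_else_)
open import Data.Product using (Σ; ∃; ∃-syntax; _×_; _,_; proj₁; proj₂)
open import Data.Sum using (_⊎_)
open import Data.List using (List; []; _∷_; map; length)
open import Data.List.Membership.Propositional using (_∈_)
open import Data.List.Relation.Unary.Unique.Propositional using (Unique)
open import Data.List.Relation.Unary.All using (All)
open import Data.Vec as Vec using (Vec; tabulate; zipWith; replicate; lookup)
open import Data.Fin.Subset using (Subset) renaming (∣_∣ to card)
open import Relation.Nullary using (¬_)
open import Relation.Binary.PropositionalEquality using (_≡_; _≢_)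
open import Relation.Binary.Construct.Closure.ReflexiveTransitive using (Star)

∑ : ∀ {m} → (Fin m → ℤ) → ℤ
∑ {zero}  f = 0ℤ
∑ {suc m} f = f zero + ∑ (λ i → f (suc i))

iter : ∀ {A : Set} → (A → A) → ℕ → A → A
iter f zero    x = x
iter f (suc k) x = f (iter f k x)

-- A walk in a (multi)graph whose oriented edges ("darts") have type D,
-- given by its list of darts: Walk t h a b ds  says ds is a walk from a to b,
-- where t / h give the tail / head vertex of a dart.
data Walk {D V : Set} (t h : D → V) : V → V → List D → Set where
  []  : ∀ {a} → Walk t h a a []
  _∷_ : ∀ {a b d ds} → t d ≡ a → Walk t h (h d) b ds → Walk t h a b (d ∷ ds)

-- Darts (oriented edges) of a graph with edge set Fin m.
-- (e , true) is the reference orientation of e, (e , false) the reverse one.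

Dart : ℕ → Set
Dart m = Fin m × Bool

edge : ∀ {m} → Dart m → Fin m
edge = proj₁

rev : ∀ {m} → Dart m → Dart m
rev (e , b) = (e , not b)

-- Edge space E(H) of a graph with edge set Fin m: ℤ^m, coordinates w.r.t.
-- the reference orientations (e , true); the reverse orientation is its negative.
EdgeSpace : ℕ → Set
EdgeSpace m = Fin m → ℤ

zeroE : ∀ {m} → EdgeSpace m
zeroE _ = 0ℤ

_⊕_ : ∀ {m} → EdgeSpace m → EdgeSpace m → EdgeSpace m
(ρ ⊕ σ) e = ρ e + σ e

sign : Bool → ℤ
sign true  = + 1
sign false = - (+ 1)

unit : ∀ {m} → Dart m → EdgeSpace m
unit (e , b) e' with e Data.Fin.≟ e'
... | Relation.Nullary.yes _ = sign b
... | Relation.Nullary.no  _ = 0ℤ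

oriented : ∀ {m} → List (Dart m) → EdgeSpace m
oriented []       = zeroE
oriented (d ∷ ds) = unit d ⊕ oriented ds

-- |ρ| = sum of the coefficients in the reduced representation = ∑ |ρ_e|
norm : ∀ {m} → EdgeSpace m → ℕ
norm {zero}  ρ = 0
norm {suc m} ρ = ℤ.∣ ρ zero ∣ ℕ.+ norm (λ i → ρ (suc i))

pair : ∀ {m} → EdgeSpace m → EdgeSpace m → ℤ
pair ρ σ = ∑ (λ e → ρ e * σ e)

-- A connected loopless multigraph G = (Fin n, Fin m), cellularly embedded
-- on a closed orientable surface of genus g, given combinatorially by a
-- rotation system (combinatorial map); its faces are the orbits of
-- φ = σ ∘ rev and are labelled by Fin f (the vertex set V' of D(G)).

tailOf : ∀ {n m} → (Fin m → Fin n × Fin n) → Dart m → Fin n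
tailOf ends (e , true)  = proj₁ (ends e)
tailOf ends (e , false) = proj₂ (ends e)

record EmbeddedGraph (n m : ℕ) : Set where
  field
    ends     : Fin m → Fin n × Fin n
  tl : Dart m → Fin n
  tl = tailOf ends
  hd : Dart m → Fin n
  hd d = tl (rev d)
  field
    loopless  : ∀ e → proj₁ (ends e) ≢ proj₂ (ends e)
    connected : ∀ a b → ∃ λ ds → Walk tl hd a b ds
    σ         : Dart m → Dart m
    σ⁻¹       : Dart m → Dart m
    σ-inv₁    : ∀ d → σ (σ⁻¹ d) ≡ d
    σ-inv₂    : ∀ d → σ⁻¹ (σ d) ≡ d
    σ-tail    : ∀ d → tl (σ d) ≡ tl d
    σ-cyclic  : ∀ d d' → tl d ≡ tl d' → ∃ λ k → iter σ k d ≡ d'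
  φ : Dart m → Dart m
  φ d = σ (rev d)
  field
    f         : ℕ
    face      : Dart m → Fin f
    face-orb  : ∀ d d' → face d ≡ face d' → ∃ λ k → iter φ k d ≡ d'
    orb-face  : ∀ d d' k → iter φ k d ≡ d' → face d ≡ face d'
    face-surj : (m ≡ 0 × f ≡ 1) ⊎ (∀ j → ∃ λ d → face d ≡ j)
    -- genus via Euler's formula  n - m + f = 2 - 2g
    genus     : ℕ
    euler     : n ℕ.+ f ℕ.+ 2 ℕ.* genus ≡ m ℕ.+ 2

  -- the dual D(G) = (Fin f, Fin m): the dual of the dart d is
  -- D(d) = (left(d), edge d, right(d)) = (face (rev d), edge d, face d).
  -- We use the same dart names for D(G): its dart d has
  dtl : Dart m → Fin f
  dtl d = face (rev d)
  dhd : Dart m → Fin f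
  dhd d = face d
  -- With these conventions D : E(G) → E(D(G)) is the identity on coordinates
  -- (D maps dart d of G to dart d of D(G)).
  D : EdgeSpace m → EdgeSpace m
  D ρ = ρ

open EmbeddedGraph public

-- The weight ω : E(G) → ℤ (a homomorphism, given by its values on the
-- reference orientations) and its conditions.

module _ {n m : ℕ} (G : EmbeddedGraph n m) where

  homω : (Fin m → ℤ) → EdgeSpace m → ℤ
  homω ωE ρ = pair ωE ρ

  -- ω(∑_{e = ab, a ∈ S, b ∉ S} (a,e,b))
  cutElem : Subset n → EdgeSpace m
  cutElem S e = val (e , true) + val (e , false)
    where
    val : Dart m → ℤ
    val d = if lookup S (tl G d) ∧ not (lookup S (hd G d)) then unit d e else 0ℤ

  record IsWeight (v₀ : Fin n) (ωE : Fin m → ℤ) : Set where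
    field
      bounded : ∀ d → ℤ.∣ homω ωE (unit d) ∣ ℕ.≤ n
      cut     : ∀ (S : Subset n) → lookup S v₀ ≡ true →
                homω ωE (cutElem S) ≡ + (n ∸ card S)

  -- ω̂ = ω ∘ D⁻¹ on E(D(G))
  homω̂ : (Fin m → ℤ) → EdgeSpace m → ℤ
  homω̂ ωE σ' = homω ωE σ'   -- D⁻¹ is the identity on coordinates

  -- Systems of loops: 2g cycles of G through a common vertex x, pairwise
  -- sharing only x (and no edges), whose union cuts the surface into a
  -- single disk, i.e. the rotation system induced on the union has exactly
  -- one face (by Euler's formula this face is then a disk).

  module _ {k : ℕ} (c : Fin k → List (Dart m)) where

    inU : Dart m → Set
    inU d = ∃ λ i → edge d ∈ map edge (c i)

    -- next dart of the union in the rotation around tl d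
    nextU : Dart m → Dart m → Set
    nextU d d' = ∃ λ j → iter (σ G) (suc j) d ≡ d' × inU d' ×
                 (∀ i → i ℕ.< j → ¬ inU (iter (σ G) (suc i) d))

    -- one step of the induced face permutation σ_U ∘ rev
    faceStepU : Dart m → Dart m → Set
    faceStepU d d' = nextU (rev d) d'

    OneFace : Set
    OneFace = ∀ d d' → inU d → inU d' → Star faceStepU d d'

  record IsCycleAt (x : Fin n) (ds : List (Dart m)) : Set where
    field
      walk      : Walk (tl G) (hd G) x x ds
      nonempty  : ds ≢ []
      vdistinct : Unique (map (tl G) ds)
      edistinct : Unique (map edge ds)

  record SystemOfLoops : Set where
    field
      base    : Fin n
      loops   : Fin (2 ℕ.* genus G) → List (Dart m)
      cycles  : ∀ i → IsCycleAt base (loops i)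
      disjE   : ∀ i j → i ≢ j → ∀ d d' → d ∈ loops i → d' ∈ loops j → edge d ≢ edge d'
      disjV   : ∀ i j → i ≢ j → ∀ d d' → d ∈ loops i → d' ∈ loops j →
                tl G d ≡ tl G d' → tl G d ≡ base
      oneFace : OneFace loops
  open SystemOfLoops public

  Θ : SystemOfLoops → EdgeSpace m → Vec ℤ (2 ℕ.* genus G)
  Θ L σ' = tabulate (λ i → pair (D G (oriented (loops L i))) σ')

  -- The graph H*: vertices (u , k , v) ∈ Fin f × {-mn..mn} × {-m..m}^{2g};
  -- for every dart d of D(G) an edge from (dtl d, k, v) to
  -- (dhd d, k + ω̂(d), v + Θ(d)) when both ends are in the vertex set.

  record State : Set where
    constructor ⟨_,_,_⟩
    field
      u : Fin (f G)
      k : ℤ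
      v : Vec ℤ (2 ℕ.* genus G)

  InRange : State → Set
  InRange ⟨ u , k , v ⟩ = ℤ.∣ k ∣ ℕ.≤ m ℕ.* n × All (λ x → ℤ.∣ x ∣ ℕ.≤ m) (Vec.toList v)

  module _ (ωE : Fin m → ℤ) (L : SystemOfLoops) where

    step : State → Dart m → State
    step ⟨ u , k , v ⟩ d =
      ⟨ dhd G d , k + homω̂ ωE (unit d) , zipWith _+_ v (Θ L (unit d)) ⟩

    -- HWalk s t ds : a walk in H* from s to t, traversing the darts ds of D(G)
    -- (ds is then the projection of the walk to D(G); its length is length ds)
    data HWalk : State → State → List (Dart m) → Set where
      hnil  : ∀ {s} → InRange s → HWalk s s []
      hcons : ∀ {s t d ds} → InRange s → dtl G d ≡ State.u s →
              HWalk (step s d) t ds → HWalk s t (d ∷ ds)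

    Reaches : ℤ → Vec ℤ (2 ℕ.* genus G) → Fin (f G) → List (Dart m) → Set
    Reaches k v u ds = HWalk ⟨ u , 0ℤ , replicate _ 0ℤ ⟩ ⟨ u , k , v ⟩ ds

  IsCircuit : List (Dart m) → Set
  IsCircuit ds = (∃ λ a → Walk (dtl G) (dhd G) a a ds) × Unique (map edge ds)

-- A circuit of D(G) uses each edge once, so |w| is its length, and with at
-- most m edges it lifts to a closed walk of H* from (u,0,0) to (u,k,v): after
-- j steps the ω̂-coordinate has absolute value at most n·j and every
-- Θ-coordinate at most j, because |ω̂| ≤ n on single darts and each loop c(i)
-- has distinct edges.  Hence w(k,v) is defined, and a shortest such path p
-- satisfies |p| ≤ length p ≤ length w = |w|.
module Submission where

open import Defs
open import Data.Nat using (ℕ; _≤_)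
open import Data.Integer using (ℤ)
open import Data.Fin using (Fin)
open import Data.Vec using (Vec)
open import Data.List using (List; length)
open import Data.Product using (_×_; ∃; ∃-syntax; _,_)
open import Relation.Binary.PropositionalEquality using (_≡_)

open import Data.Nat as ℕ using (zero; suc; z≤n; s≤s)
import Data.Nat.Properties as ℕ
open import Data.Integer as ℤ using (0ℤ; _+_; _*_; ∣_∣)
import Data.Integer.Properties as ℤ
open import Data.Fin using (zero; suc; _≟_)
open import Data.Bool using (true; false)
open import Data.Empty using (⊥-elim)
open import Data.List using ([]; _∷_; map; foldl)
open import Data.List.Relation.Unary.All as List using ([]; _∷_)
open import Data.List.Relation.Unary.AllPairs using ([]; _∷_)
open import Data.List.Relation.Unary.Unique.Propositional using (Unique)
open import Data.Vec using ([]; _∷_; tabulate; zipWith; replicate)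
import Data.Vec.Properties as Vec
open import Data.Vec.Relation.Unary.All as VecAll using ([]; _∷_)
open import Data.Vec.Relation.Unary.All.Properties using (tabulate⁺; toList⁺)
open import Relation.Nullary using (yes; no)
open import Relation.Binary.PropositionalEquality
  using (_≢_; _≗_; refl; sym; trans; cong; cong₂; subst; module ≡-Reasoning)
open import Algebra.Properties.CommutativeSemigroup ℤ.+-commutativeSemigroup
  using (interchange)
open import Algebra.Properties.CommutativeSemigroup ℕ.+-commutativeSemigroup
  using () renaming (interchange to ℕ-interchange)

module _ {m : ℕ} where

  unit-offDiagonal : ∀ {e e' : Fin m} b → e ≢ e' → unit (e , b) e' ≡ 0ℤ
  unit-offDiagonal {e} {e'} b e≢e' with e ≟ e'
  ... | yes e≡e' = ⊥-elim (e≢e' e≡e')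
  ... | no _     = refl

  unit-suc : ∀ (e i : Fin m) b → unit (suc e , b) (suc i) ≡ unit (e , b) i
  unit-suc e i b with e ≟ i
  ... | yes _ = refl
  ... | no _  = refl

∣sign∣≡1 : ∀ b → ∣ sign b ∣ ≡ 1
∣sign∣≡1 true  = refl
∣sign∣≡1 false = refl

norm-cong : ∀ {m} {ρ σ : EdgeSpace m} → ρ ≗ σ → norm ρ ≡ norm σ
norm-cong {zero}  ρ≗σ = refl
norm-cong {suc m} ρ≗σ = cong₂ ℕ._+_ (cong ∣_∣ (ρ≗σ zero)) (norm-cong (λ i → ρ≗σ (suc i)))

norm-zeroE : ∀ {m} → norm (zeroE {m}) ≡ 0
norm-zeroE {zero}  = refl
norm-zeroE {suc m} = norm-zeroE {m}

norm-triangle : ∀ {m} (ρ σ : EdgeSpace m) → norm (ρ ⊕ σ) ≤ norm ρ ℕ.+ norm σ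
norm-triangle {zero}  ρ σ = z≤n
norm-triangle {suc m} ρ σ = ℕ.≤-trans
  (ℕ.+-mono-≤ (ℤ.∣i+j∣≤∣i∣+∣j∣ (ρ zero) (σ zero)) (norm-triangle (λ i → ρ (suc i)) (λ i → σ (suc i))))
  (ℕ.≤-reflexive (ℕ-interchange ∣ ρ zero ∣ ∣ σ zero ∣ _ _))

norm-unit⊕ : ∀ {m} (d : Dart m) (ρ : EdgeSpace m) → ρ (edge d) ≡ 0ℤ →
             norm (unit d ⊕ ρ) ≡ suc (norm ρ)
norm-unit⊕ {suc m} (zero , b) ρ ρ₀≡0 = cong₂ ℕ._+_
  (begin
    ∣ sign b + ρ zero ∣ ≡⟨ cong (λ x → ∣ sign b + x ∣) ρ₀≡0 ⟩
    ∣ sign b + 0ℤ ∣     ≡⟨ cong ∣_∣ (ℤ.+-identityʳ (sign b)) ⟩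
    ∣ sign b ∣          ≡⟨ ∣sign∣≡1 b ⟩
    1                   ≡⟨ cong (λ x → suc ∣ x ∣) ρ₀≡0 ⟨
    suc ∣ ρ zero ∣      ∎)
  (norm-cong {m} (λ i → ℤ.+-identityˡ (ρ (suc i))))
  where open ≡-Reasoning
norm-unit⊕ {suc m} (suc e , b) ρ ρₑ≡0 = begin
  ∣ 0ℤ + ρ zero ∣ ℕ.+ norm (λ i → unit (suc e , b) (suc i) + ρ (suc i))
    ≡⟨ cong₂ ℕ._+_ (cong ∣_∣ (ℤ.+-identityˡ (ρ zero)))
                   (norm-cong (λ i → cong (_+ ρ (suc i)) (unit-suc e i b))) ⟩
  ∣ ρ zero ∣ ℕ.+ norm (unit (e , b) ⊕ (λ i → ρ (suc i)))
    ≡⟨ cong (∣ ρ zero ∣ ℕ.+_) (norm-unit⊕ (e , b) (λ i → ρ (suc i)) ρₑ≡0) ⟩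
  ∣ ρ zero ∣ ℕ.+ suc (norm (λ i → ρ (suc i)))
    ≡⟨ ℕ.+-suc ∣ ρ zero ∣ _ ⟩
  suc (norm ρ) ∎
  where open ≡-Reasoning

norm-unit : ∀ {m} (d : Dart m) → norm (unit d) ≡ 1
norm-unit {m} d = begin
  norm (unit d)          ≡⟨ norm-cong (λ e → sym (ℤ.+-identityʳ (unit d e))) ⟩
  norm (unit d ⊕ zeroE)  ≡⟨ norm-unit⊕ d zeroE refl ⟩
  suc (norm (zeroE {m})) ≡⟨ cong suc (norm-zeroE {m}) ⟩
  1                      ∎
  where open ≡-Reasoning

norm-oriented≤length : ∀ {m} (ds : List (Dart m)) → norm (oriented ds) ≤ length ds
norm-oriented≤length {m} [] = ℕ.≤-reflexive (norm-zeroE {m})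
norm-oriented≤length (d ∷ ds) = ℕ.≤-trans (norm-triangle (unit d) (oriented ds))
  (subst (λ x → x ℕ.+ norm (oriented ds) ≤ suc (length ds)) (sym (norm-unit d))
         (s≤s (norm-oriented≤length ds)))

oriented-fresh : ∀ {m} {e : Fin m} (ds : List (Dart m)) →
                 List.All (e ≢_) (map edge ds) → oriented ds e ≡ 0ℤ
oriented-fresh []             []            = refl
oriented-fresh ((e' , b) ∷ ds) (e≢e' ∷ fresh) =
  cong₂ _+_ (unit-offDiagonal b (λ e'≡e → e≢e' (sym e'≡e))) (oriented-fresh ds fresh)

norm-oriented-unique : ∀ {m} (ds : List (Dart m)) → Unique (map edge ds) →
                       norm (oriented ds) ≡ length ds
norm-oriented-unique {m} []       []             = norm-zeroE {m}
norm-oriented-unique      (d ∷ ds) (fresh ∷ uniq) =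
  trans (norm-unit⊕ d (oriented ds) (oriented-fresh ds fresh))
        (cong suc (norm-oriented-unique ds uniq))

∣oriented∣≤1 : ∀ {m} (ds : List (Dart m)) → Unique (map edge ds) →
               ∀ e → ∣ oriented ds e ∣ ≤ 1
∣oriented∣≤1 []               []             e = z≤n
∣oriented∣≤1 ((e' , b) ∷ ds) (fresh ∷ uniq) e with e' ≟ e
... | yes refl = ℕ.≤-reflexive (begin
  ∣ sign b + oriented ds e' ∣ ≡⟨ cong (λ x → ∣ sign b + x ∣) (oriented-fresh ds fresh) ⟩
  ∣ sign b + 0ℤ ∣             ≡⟨ cong ∣_∣ (ℤ.+-identityʳ (sign b)) ⟩
  ∣ sign b ∣                  ≡⟨ ∣sign∣≡1 b ⟩
  1                           ∎)
  where open ≡-Reasoning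
... | no _ = subst (λ x → ∣ x ∣ ≤ 1) (sym (ℤ.+-identityˡ (oriented ds e))) (∣oriented∣≤1 ds uniq e)

∣pair∣≤norm : ∀ {m} (c ρ : EdgeSpace m) → (∀ e → ∣ c e ∣ ≤ 1) → ∣ pair c ρ ∣ ≤ norm ρ
∣pair∣≤norm {zero}  c ρ ∣c∣≤1 = z≤n
∣pair∣≤norm {suc m} c ρ ∣c∣≤1 = ℕ.≤-trans
  (ℤ.∣i+j∣≤∣i∣+∣j∣ (c zero * ρ zero) (pair (λ i → c (suc i)) (λ i → ρ (suc i))))
  (ℕ.+-mono-≤ ∣c₀ρ₀∣≤∣ρ₀∣ (∣pair∣≤norm (λ i → c (suc i)) (λ i → ρ (suc i)) (λ i → ∣c∣≤1 (suc i))))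
  where
  ∣c₀ρ₀∣≤∣ρ₀∣ : ∣ c zero * ρ zero ∣ ≤ ∣ ρ zero ∣
  ∣c₀ρ₀∣≤∣ρ₀∣ = begin
    ∣ c zero * ρ zero ∣        ≡⟨ ℤ.∣i*j∣≡∣i∣*∣j∣ (c zero) (ρ zero) ⟩
    ∣ c zero ∣ ℕ.* ∣ ρ zero ∣  ≤⟨ ℕ.*-monoˡ-≤ ∣ ρ zero ∣ (∣c∣≤1 zero) ⟩
    1 ℕ.* ∣ ρ zero ∣           ≡⟨ ℕ.*-identityˡ ∣ ρ zero ∣ ⟩
    ∣ ρ zero ∣                 ∎
    where open ℕ.≤-Reasoning

pair-⊕ : ∀ {m} (c ρ σ : EdgeSpace m) → pair c (ρ ⊕ σ) ≡ pair c ρ + pair c σ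
pair-⊕ {zero}  c ρ σ = refl
pair-⊕ {suc m} c ρ σ = trans
  (cong₂ _+_ (ℤ.*-distribˡ-+ (c zero) (ρ zero) (σ zero))
             (pair-⊕ (λ i → c (suc i)) (λ i → ρ (suc i)) (λ i → σ (suc i))))
  (interchange (c zero * ρ zero) (c zero * σ zero) _ _)

pair-zeroE : ∀ {m} (c : EdgeSpace m) → pair c zeroE ≡ 0ℤ
pair-zeroE {zero}  c = refl
pair-zeroE {suc m} c = cong₂ _+_ (ℤ.*-zeroʳ (c zero)) (pair-zeroE (λ i → c (suc i)))

tabulate-const : ∀ {A : Set} {k} (x : A) → tabulate {n = k} (λ _ → x) ≡ replicate k x
tabulate-const {k = zero}  x = refl
tabulate-const {k = suc k} x = cong (x ∷_) (tabulate-const x)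

zipWith-tabulate : ∀ {A B C : Set} {k} (_∙_ : A → B → C) (f : Fin k → A) (g : Fin k → B) →
                   zipWith _∙_ (tabulate f) (tabulate g) ≡ tabulate (λ i → f i ∙ g i)
zipWith-tabulate {k = zero}  _∙_ f g = refl
zipWith-tabulate {k = suc k} _∙_ f g =
  cong (f zero ∙ g zero ∷_) (zipWith-tabulate _∙_ (λ i → f (suc i)) (λ i → g (suc i)))

module _ {n m : ℕ} (G : EmbeddedGraph n m) (L : SystemOfLoops G) where

  Θ-⊕ : ∀ ρ σ → Θ G L (ρ ⊕ σ) ≡ zipWith _+_ (Θ G L ρ) (Θ G L σ)
  Θ-⊕ ρ σ = trans (Vec.tabulate-cong (λ i → pair-⊕ (oriented (loops L i)) ρ σ))
                  (sym (zipWith-tabulate _+_ _ _))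

  Θ-zeroE : Θ G L zeroE ≡ replicate _ 0ℤ
  Θ-zeroE = trans (Vec.tabulate-cong (λ i → pair-zeroE (oriented (loops L i)))) (tabulate-const 0ℤ)

  ∣Θ-unit∣≤1 : ∀ d → VecAll.All (λ x → ∣ x ∣ ≤ 1) (Θ G L (unit d))
  ∣Θ-unit∣≤1 d = tabulate⁺ λ i → ℕ.≤-trans
    (∣pair∣≤norm (oriented (loops L i)) (unit d)
                 (∣oriented∣≤1 (loops L i) (IsCycleAt.edistinct (cycles L i))))
    (ℕ.≤-reflexive (norm-unit d))

module _ {n m : ℕ} (G : EmbeddedGraph n m) {v₀ : Fin n} {ωE : Fin m → ℤ}
         (W : IsWeight G v₀ ωE) (L : SystemOfLoops G) where

  -- Holds after j steps from (u , 0 , 0); for j ≤ m it keeps a walk inside the vertex set of H*.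
  Bounded : ℕ → State G → Set
  Bounded j ⟨ u , k , v ⟩ = ∣ k ∣ ≤ n ℕ.* j × VecAll.All (λ x → ∣ x ∣ ≤ j) v

  bounded-step : ∀ {j} s d → Bounded j s → Bounded (suc j) (step G ωE L s d)
  bounded-step {j} ⟨ u , k , v ⟩ d (∣k∣≤nj , ∣v∣≤j) =
    ∣k+ω̂d∣≤n[1+j] , VecAll.zipWith (λ {x} {y} → ∣x+y∣≤1+j {x} {y}) ∣v∣≤j (∣Θ-unit∣≤1 G L d)
    where
    ∣x+y∣≤1+j : ∀ {x y} → ∣ x ∣ ≤ j → ∣ y ∣ ≤ 1 → ∣ x + y ∣ ≤ suc j
    ∣x+y∣≤1+j {x} {y} ∣x∣≤j ∣y∣≤1 = ℕ.≤-trans (ℤ.∣i+j∣≤∣i∣+∣j∣ x y)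
      (ℕ.≤-trans (ℕ.+-mono-≤ ∣x∣≤j ∣y∣≤1) (ℕ.≤-reflexive (ℕ.+-comm j 1)))

    ∣k+ω̂d∣≤n[1+j] : ∣ k + homω̂ G ωE (unit d) ∣ ≤ n ℕ.* suc j
    ∣k+ω̂d∣≤n[1+j] = begin
      ∣ k + homω̂ G ωE (unit d) ∣          ≤⟨ ℤ.∣i+j∣≤∣i∣+∣j∣ k _ ⟩
      ∣ k ∣ ℕ.+ ∣ homω̂ G ωE (unit d) ∣    ≤⟨ ℕ.+-mono-≤ ∣k∣≤nj (IsWeight.bounded W d) ⟩
      n ℕ.* j ℕ.+ n                        ≡⟨ ℕ.+-comm (n ℕ.* j) n ⟩
      n ℕ.+ n ℕ.* j                        ≡⟨ ℕ.*-suc n j ⟨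
      n ℕ.* suc j                          ∎
      where open ℕ.≤-Reasoning

  bounded⇒InRange : ∀ {j} s → j ≤ m → Bounded j s → InRange G s
  bounded⇒InRange {j} ⟨ u , k , v ⟩ j≤m (∣k∣≤nj , ∣v∣≤j) =
    ℕ.≤-trans ∣k∣≤nj (ℕ.≤-trans (ℕ.*-monoʳ-≤ n j≤m) (ℕ.≤-reflexive (ℕ.*-comm n m))) ,
    toList⁺ (VecAll.map (λ ∣x∣≤j → ℕ.≤-trans ∣x∣≤j j≤m) ∣v∣≤j)

  -- Where a walk of D(G) with oriented version ρ, ending at b, ends in H* when started at level (K , V).
  displaced : Fin (f G) → ℤ → Vec ℤ (2 ℕ.* genus G) → EdgeSpace m → State G
  displaced b K V ρ = ⟨ b , K + homω̂ G ωE ρ , zipWith _+_ V (Θ G L ρ) ⟩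

  displaced-zeroE : ∀ b K V → displaced b K V zeroE ≡ ⟨ b , K , V ⟩
  displaced-zeroE b K V = cong₂ (λ k v → ⟨ b , k , v ⟩)
    (trans (cong (_+_ K) (pair-zeroE ωE)) (ℤ.+-identityʳ K))
    (trans (cong (zipWith _+_ V) (Θ-zeroE G L)) (Vec.zipWith-identityʳ ℤ.+-identityʳ V))

  displaced-⊕ : ∀ b K V ρ σ →
    displaced b (K + homω̂ G ωE ρ) (zipWith _+_ V (Θ G L ρ)) σ ≡ displaced b K V (ρ ⊕ σ)
  displaced-⊕ b K V ρ σ = cong₂ (λ k v → ⟨ b , k , v ⟩)
    (trans (ℤ.+-assoc K _ _) (cong (_+_ K) (sym (pair-⊕ ωE ρ σ))))
    (trans (Vec.zipWith-assoc ℤ.+-assoc V _ _) (cong (zipWith _+_ V) (sym (Θ-⊕ G L ρ σ))))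

  run : State G → List (Dart m) → State G
  run = foldl (step G ωE L)

  run-displaced : ∀ {a b} K V ds → Walk (dtl G) (dhd G) a b ds →
                  run ⟨ a , K , V ⟩ ds ≡ displaced b K V (oriented ds)
  run-displaced {a} K V []       []         = sym (displaced-zeroE a K V)
  run-displaced {b = b} K V (d ∷ ds) (_ ∷ walk) =
    trans (run-displaced _ _ ds walk) (displaced-⊕ b K V (unit d) (oriented ds))

  lift : ∀ {a b j} s ds → State.u s ≡ a → Walk (dtl G) (dhd G) a b ds →
         Bounded j s → j ℕ.+ length ds ≤ m → HWalk G ωE L s (run s ds) ds
  lift {j = j} s [] _ [] bounded j≤m =
    hnil (bounded⇒InRange s (ℕ.≤-trans (ℕ.m≤m+n j 0) j≤m) bounded)
  lift {j = j} s (d ∷ ds) refl (d-from-a ∷ walk) bounded j+len≤m =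
    hcons (bounded⇒InRange s (ℕ.≤-trans (ℕ.m≤m+n j _) j+len≤m) bounded) d-from-a
          (lift (step G ωE L s d) ds refl walk (bounded-step s d bounded)
                (ℕ.≤-trans (ℕ.≤-reflexive (sym (ℕ.+-suc j _))) j+len≤m))

  closedWalk-reaches : ∀ {a} ds → Walk (dtl G) (dhd G) a a ds → length ds ≤ m →
    Reaches G ωE L (homω̂ G ωE (oriented ds)) (Θ G L (oriented ds)) a ds
  closedWalk-reaches {a} ds walk len≤m =
    subst (λ t → HWalk G ωE L origin t ds) ends-at-target
          (lift origin ds refl walk bounded-origin len≤m)
    where
    origin : State G
    origin = ⟨ a , 0ℤ , replicate _ 0ℤ ⟩
    bounded-origin : Bounded 0 origin
    bounded-origin = z≤n , subst (VecAll.All (λ x → ∣ x ∣ ≤ 0)) (tabulate-const 0ℤ) (tabulate⁺ (λ _ → z≤n))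
    ends-at-target : run origin ds ≡ ⟨ a , homω̂ G ωE (oriented ds) , Θ G L (oriented ds) ⟩
    ends-at-target = trans (run-displaced 0ℤ _ ds walk)
      (cong₂ (λ k v → ⟨ a , k , v ⟩) (ℤ.+-identityˡ _) (Vec.zipWith-identityˡ ℤ.+-identityˡ _))

lemma5 : ∀ {n m : ℕ} (G : EmbeddedGraph n m) (v₀ : Fin n) (ωE : Fin m → ℤ) →
    IsWeight G v₀ ωE → (L : SystemOfLoops G) →
    (w : List (Dart m)) (k : ℤ) (v : Vec ℤ (2 Data.Nat.* genus G)) →
    IsCircuit G w →
    homω̂ G ωE (oriented w) ≡ k →
    Θ G L (oriented w) ≡ v →
    norm (oriented w) ≤ m →
    (∃[ u ] ∃[ p ] Reaches G ωE L k v u p)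
    ×
    (∀ u p → Reaches G ωE L k v u p →
      (∀ u' p' → Reaches G ωE L k v u' p' → length p ≤ length p') →
      norm (oriented p) ≤ norm (oriented w))
lemma5 {m = m} G v₀ ωE W L w _ _ ((a , closed) , distinct) refl refl |w|≤m =
  (a , w , w-reaches) , λ u p _ p-shortest → begin
    norm (oriented p) ≤⟨ norm-oriented≤length p ⟩
    length p          ≤⟨ p-shortest a w w-reaches ⟩
    length w          ≡⟨ norm-oriented-unique w distinct ⟨
    norm (oriented w) ∎
  where
  open ℕ.≤-Reasoning
  w-reaches : Reaches G ωE L (homω̂ G ωE (oriented w)) (Θ G L (oriented w)) a w
  w-reaches = closedWalk-reaches G W L w closed
    (subst (_≤ m) (norm-oriented-unique w distinct) |w|≤m)
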